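{- Assume function extensionality, propositional truncations and excluded middle. If $A,B:\mathcal{U}$ are rigid types with $\neg(A\simeq B)$, then there is an automorphism $f:\mathcal{U}\to\mathcal{U}$ such that $f(A)\simeq B$.
   Context: Work in intensional Martin-Löf type theory with $\Pi$-, $\Sigma$-, identity, finite types and natural numbers, and a universe $\mathcal{U}$ closed under these, with propositional truncations $\|C\|$. A type is a proposition if any two elements are equal; a type $C$ is contractible if $\sum_{c:C}\prod_{c':C}(c=c')$. Excluded middle: for every proposition $P:\mathcal{U}$, $P+\neg P$. An equivalence is a map with a left and a right inverse; $C\simeq D$ means there is one; an automorphism of $\mathcal{U}$ is an equivalence $\mathcal{U}\to\mathcal{U}$. For $X:\mathcal{U}$, $\mathcal{U}_X:=\sum_{Z:\mathcal{U}}\|Z=X\|$, and $X$ is rigid if $\mathcal{U}_X$ is contractible. -}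

module Defs where

open import Level using (Level; _⊔_; Setω) renaming (suc to lsuc)
open import Data.Product using (Σ; _×_; _,_)
open import Data.Sum using (_⊎_)
open import Relation.Nullary using (¬_)
open import Relation.Binary.PropositionalEquality using (_≡_)
open import Axiom.Extensionality.Propositional using (Extensionality)

isProp : ∀ {ℓ} → Set ℓ → Set ℓ
isProp C = (x y : C) → x ≡ y

isContr : ∀ {ℓ} → Set ℓ → Set ℓ
isContr C = Σ C λ c → (c' : C) → c ≡ c'

isEquiv : ∀ {a b} {C : Set a} {D : Set b} → (C → D) → Set (a ⊔ b)
isEquiv {C = C} {D = D} f =
  (Σ (D → C) λ g → (x : C) → g (f x) ≡ x) × (Σ (D → C) λ h → (y : D) → f (h y) ≡ y)

_≃_ : ∀ {a b} → Set a → Set b → Set (a ⊔ b)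
C ≃ D = Σ (C → D) isEquiv

FunExt : Setω
FunExt = ∀ {a b} → Extensionality a b

LEM : Setω
LEM = ∀ {ℓ} (P : Set ℓ) → isProp P → P ⊎ ¬ P

-- Propositional truncations, assumed as a structure (Agda --safe has no HITs).
record PropTrunc : Setω where
  field
    ∥_∥ : ∀ {ℓ} → Set ℓ → Set ℓ
    ∣_∣ : ∀ {ℓ} {C : Set ℓ} → C → ∥ C ∥
    ∥∥-isProp : ∀ {ℓ} {C : Set ℓ} → isProp ∥ C ∥
    ∥∥-rec : ∀ {ℓ ℓ'} {C : Set ℓ} {P : Set ℓ'} → isProp P → (C → P) → ∥ C ∥ → P

module _ (pt : PropTrunc) where
  open PropTrunc pt

  𝒰[_] : Set → Set₁
  𝒰[ X ] = Σ Set λ Z → ∥ Z ≡ X ∥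

  isRigid : Set → Set₁
  isRigid X = isContr 𝒰[ X ]

module Submission where

-- An automorphism of 𝒰 sending A to B is obtained as the
-- transposition of 𝒰 exchanging the two points A and B: send X to B if X is A,
-- to A if X is B, and leave it fixed otherwise.  This makes sense on any type
-- in which equality with the two chosen points is decidable, and there it is
-- an involution, hence an equivalence.
-- The theorem is then the transposition of 𝒰 at the rigid points A and B.

open import Defs
open import Function using (_∘_)
open import Data.Product using (Σ; _×_; _,_; proj₁)
open import Data.Sum using (map)
open import Relation.Nullary using (¬_; Dec; yes; no; contradiction)
open import Relation.Nullary.Decidable using (fromSum)
open import Relation.Binary.PropositionalEquality
  using (_≡_; refl; sym; trans; cong; module ≡-Reasoning)
open ≡-Reasoning

involution-isEquiv : ∀ {a} {C : Set a} (f : C → C) →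
  ((x : C) → f (f x) ≡ x) → isEquiv f
involution-isEquiv f ff = (f , ff) , (f , ff)

≡→≃ : {C D : Set} → C ≡ D → C ≃ D
≡→≃ refl = (λ x → x) , involution-isEquiv (λ x → x) (λ _ → refl)

isContr→isProp : ∀ {ℓ} {C : Set ℓ} → isContr C → isProp C
isContr→isProp (_ , centre) x y = trans (sym (centre x)) (centre y)

module Transposition {ℓ} {T : Set ℓ} (a b : T)
  (a? : (x : T) → Dec (x ≡ a)) (b? : (x : T) → Dec (x ≡ b)) where

  swapBy : (x : T) → Dec (x ≡ a) → Dec (x ≡ b) → T
  swapBy x (yes _) _       = b
  swapBy x (no _)  (yes _) = a
  swapBy x (no _)  (no _)  = x

  swap : T → T
  swap x = swapBy x (a? x) (b? x)

  swap-a : swap a ≡ b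
  swap-a with a? a
  ... | yes _  = refl
  ... | no a≢a = contradiction refl a≢a

  -- If b happens to be a, the first clause fires and returns b, which is a.
  swap-b : swap b ≡ a
  swap-b with a? b | b? b
  ... | yes b≡a | _      = b≡a
  ... | no _    | yes _  = refl
  ... | no _    | no b≢b = contradiction refl b≢b

  swap-other : {x : T} → ¬ (x ≡ a) → ¬ (x ≡ b) → swap x ≡ x
  swap-other {x} x≢a x≢b with a? x | b? x
  ... | yes x≡a | _       = contradiction x≡a x≢a
  ... | no _    | yes x≡b = contradiction x≡b x≢b
  ... | no _    | no _    = refl

  swap-involutive : (x : T) → swap (swap x) ≡ x
  swap-involutive x = byKind (a? x) (b? x)
    where
    byKind : Dec (x ≡ a) → Dec (x ≡ b) → swap (swap x) ≡ x
    byKind (yes x≡a) _ = begin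
      swap (swap x) ≡⟨ cong (swap ∘ swap) x≡a ⟩
      swap (swap a) ≡⟨ cong swap swap-a ⟩
      swap b        ≡⟨ swap-b ⟩
      a             ≡⟨ sym x≡a ⟩
      x             ∎
    byKind (no _) (yes x≡b) = begin
      swap (swap x) ≡⟨ cong (swap ∘ swap) x≡b ⟩
      swap (swap b) ≡⟨ cong swap swap-b ⟩
      swap a        ≡⟨ swap-a ⟩
      b             ≡⟨ sym x≡b ⟩
      x             ∎
    byKind (no x≢a) (no x≢b) = begin
      swap (swap x) ≡⟨ cong swap (swap-other x≢a x≢b) ⟩
      swap x        ≡⟨ swap-other x≢a x≢b ⟩
      x             ∎

module _ (pt : PropTrunc) where
  open PropTrunc pt

  -- A rigid type C is the only inhabitant of 𝒰[ C ], so merely being equal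
  -- to C already yields an actual path to C.
  rigid-path : {C X : Set} → isRigid pt C → ∥ X ≡ C ∥ → X ≡ C
  rigid-path {C} {X} rC t =
    cong proj₁ (isContr→isProp rC (X , t) (C , ∣ refl ∣))

  -- Under excluded middle, equality with a rigid type is decidable: decide
  -- the proposition ∥ X ≡ C ∥ and strengthen a positive answer by rigidity.
  rigid-isolated : LEM → {C : Set} → isRigid pt C → (X : Set) → Dec (X ≡ C)
  rigid-isolated lem {C} rC X =
    fromSum (map (rigid-path rC) (_∘ ∣_∣) (lem ∥ X ≡ C ∥ ∥∥-isProp))

theorem3p3 : (pt : PropTrunc) → FunExt → LEM →
    (A B : Set) → isRigid pt A → isRigid pt B → ¬ (A ≃ B) →
    Σ (Set → Set) λ f → isEquiv f × (f A ≃ B)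
theorem3p3 pt _ lem A B rA rB _ =
  swap , involution-isEquiv swap swap-involutive , ≡→≃ swap-a
  where
  open Transposition A B (rigid-isolated pt lem rA) (rigid-isolated pt lem rB)
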